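{- Let $n$ be a positive integer and let $w_1 \leq \dots \leq w_m$ be a feasible partition of $n$. Then for every $i$ with $1 \leq i \leq m$, $w_i \leq 3^{i-1}$ and $R_i \leq \frac{3^i - 1}{2}$. Moreover, these bounds are the highest possible: for every $m \geq 1$ there is a feasible partition with $m$ parts for which $w_i = 3^{i-1}$ and $R_i = \frac{3^i-1}{2}$ for all $1 \leq i \leq m$.
   Context: A feasible partition of a positive integer $n$ is a nondecreasing sequence of positive integers $w_1 \leq \dots \leq w_m$ with $w_1 + \dots + w_m = n$ such that (i) every integer $k$ with $1 \leq k \leq n$ can be written as $k = \sum_{i=1}^m u_i w_i$ with each $u_i \in \{ -1,0,1\}$, and (ii) $m$ is the minimum possible number of parts among all sequences of positive integers summing to $n$ with property (i). For such a partition, $R_i = w_1 + \dots + w_i$ for $1 \leq i \leq m$, and $R_0 = 0$. -}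

module Defs where

open import Data.Nat using (ℕ; zero; suc; _+_; _*_; _≤_; _<_)
open import Data.Integer using (ℤ; +_; -[1+_]; 0ℤ; 1ℤ)
import Data.Integer as ℤ
open import Data.List using (List; []; _∷_; length; take; lookup)
open import Data.Nat.ListAction using (sum)
open import Data.List.Relation.Unary.All using (All)
open import Data.List.Relation.Binary.Pointwise using (Pointwise)
open import Data.List.Relation.Unary.Sorted.TotalOrder using (Sorted)
open import Data.Nat.Properties using (≤-totalOrder)
open import Data.Product using (Σ; _×_; ∃-syntax)
open import Relation.Binary.PropositionalEquality using (_≡_)

data Sign : Set where
  neg zer pos : Sign

signVal : Sign → ℤ
signVal neg = ℤ.- 1ℤ
signVal zer = 0ℤ
signVal pos = 1ℤ

signedSum : List Sign → List ℕ → ℤ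
signedSum (u ∷ us) (w ∷ ws) = signVal u ℤ.* (+ w) ℤ.+ signedSum us ws
signedSum _ _ = 0ℤ

Representable : ℕ → List ℕ → Set
Representable k ws = Σ (List Sign) λ us → (length us ≡ length ws) × (signedSum us ws ≡ + k)

Covers : ℕ → List ℕ → Set
Covers n ws = ∀ k → 1 ≤ k → k ≤ n → Representable k ws

Admissible : ℕ → List ℕ → Set
Admissible n ws = All (λ w → 1 ≤ w) ws × (sum ws ≡ n) × Covers n ws

Minimal : ℕ → List ℕ → Set
Minimal n ws = ∀ vs → Admissible n vs → length ws ≤ length vs

Feasible : ℕ → List ℕ → Set
Feasible n ws = Sorted ≤-totalOrder ws × Admissible n ws × Minimal n ws

R : List ℕ → ℕ → ℕ
R ws i = sum (take i ws)

-- The deficit of a sign vector u is Σ (1 - u_i) w_i = n - Σ u_i w_i. Suppose the parts are sorted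
-- and w_i > 2 R_{i-1} + 1 =: d. A representation of n - d has deficit exactly d; but a deficit is
-- either at most 2 R_{i-1} (every later sign is +1) or at least w_i (some later part loses a
-- multiple of itself, and later parts are ≥ w_i). Hence w_i ≤ 2 R_{i-1} + 1, and by induction
-- 2 R_i + 1 ≤ 3^i. For the powers of three, deficits run through all ternary expansions, so
-- every 1 ≤ k ≤ n is representable; minimality follows from the bound 2 n + 1 ≤ 3^m, which after
-- sorting holds for every covering list.
module Submission where

open import Defs
open import Data.Nat using (ℕ; zero; suc; _+_; _*_; _∸_; _^_; _≤_; _<_; z≤n; s≤s; _<?_)
open import Data.Nat.Properties
open import Data.Nat.DivMod using (_/_; _%_; m≡m%n+[m/n]*n; m%n<n; m<n*o⇒m/o<n)
open import Data.Nat.ListAction using (sum)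
open import Data.Nat.ListAction.Properties using (sum-++; sum-↭)
open import Data.Integer using (+_; 0ℤ; 1ℤ)
import Data.Integer as ℤ
import Data.Integer.Properties as ℤ
open import Data.Integer.Tactic.RingSolver using (solve-∀)
import Data.Nat.Tactic.RingSolver as NatSolver
open import Algebra.Bundles using (AbelianGroup)
open import Algebra.Properties.CommutativeSemigroup ℤ.+-commutativeSemigroup using (interchange; x∙yz≈y∙xz)
open import Algebra.Properties.Group (AbelianGroup.group ℤ.+-0-abelianGroup) using (∙-cancelʳ)
open import Data.Fin using (Fin; toℕ; fromℕ<) renaming (zero to fzero; suc to fsuc)
open import Data.Fin.Properties using (toℕ<n; toℕ-fromℕ<)
open import Data.List using (List; []; _∷_; _∷ʳ_; length; lookup; take; drop; map; applyUpTo)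
open import Data.List.Properties
  using (take-suc; take-all; length-applyUpTo; lookup-applyUpTo; map-applyUpTo; applyUpTo-∷ʳ)
open import Data.List.Relation.Unary.All using (All; _∷_)
import Data.List.Relation.Unary.All.Properties as All
open import Data.List.Relation.Unary.Linked using (_∷_)
open import Data.List.Relation.Unary.Linked.Properties using (Linked⇒All)
open import Data.List.Relation.Unary.Sorted.TotalOrder using (Sorted)
import Data.List.Relation.Unary.Sorted.TotalOrder.Properties as Sorted
open import Data.List.Relation.Binary.Permutation.Propositional as ↭ using (_↭_; ↭-sym)
open import Data.List.Relation.Binary.Permutation.Propositional.Properties using (↭-length)
open import Data.List.Sort ≤-decTotalOrder using (sort; sort-↭; sort-↗)
open import Data.Product using (Σ; _×_; _,_; proj₁; proj₂)
open import Data.Sum using (_⊎_; inj₁; inj₂; map₁)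
open import Function using (_∘_)
open import Relation.Nullary using (yes; no; ¬_; contradiction)
open import Relation.Binary.PropositionalEquality
  using (_≡_; refl; sym; trans; cong; cong₂; subst; module ≡-Reasoning)

signDeficit : Sign → ℕ → ℕ
signDeficit neg w = w + w
signDeficit zer w = w
signDeficit pos w = 0

deficit : List Sign → List ℕ → ℕ
deficit (u ∷ us) (w ∷ ws) = signDeficit u w + deficit us ws
deficit _        _        = 0

signVal-+-signDeficit : ∀ u w → signVal u ℤ.* + w ℤ.+ + signDeficit u w ≡ + w
signVal-+-signDeficit neg w = trans (cong (λ x → ℤ.- 1ℤ ℤ.* + w ℤ.+ x) (ℤ.pos-+ w w)) (-a+[a+a]≡a (+ w))
  where
  -a+[a+a]≡a : ∀ a → ℤ.- 1ℤ ℤ.* a ℤ.+ (a ℤ.+ a) ≡ a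
  -a+[a+a]≡a = solve-∀
signVal-+-signDeficit zer w = 0a+a≡a (+ w)
  where
  0a+a≡a : ∀ a → 0ℤ ℤ.* a ℤ.+ a ≡ a
  0a+a≡a = solve-∀
signVal-+-signDeficit pos w = 1a+0≡a (+ w)
  where
  1a+0≡a : ∀ a → 1ℤ ℤ.* a ℤ.+ 0ℤ ≡ a
  1a+0≡a = solve-∀

signedSum-+-deficit : ∀ us ws → length us ≡ length ws →
                      signedSum us ws ℤ.+ + deficit us ws ≡ + sum ws
signedSum-+-deficit []       []       _   = refl
signedSum-+-deficit (u ∷ us) (w ∷ ws) len = begin
  (signVal u ℤ.* + w ℤ.+ signedSum us ws) ℤ.+ + (signDeficit u w + deficit us ws)
    ≡⟨ cong (λ x → signVal u ℤ.* + w ℤ.+ signedSum us ws ℤ.+ x) (ℤ.pos-+ (signDeficit u w) _) ⟩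
  (signVal u ℤ.* + w ℤ.+ signedSum us ws) ℤ.+ (+ signDeficit u w ℤ.+ + deficit us ws)
    ≡⟨ interchange (signVal u ℤ.* + w) (signedSum us ws) (+ signDeficit u w) (+ deficit us ws) ⟩
  (signVal u ℤ.* + w ℤ.+ + signDeficit u w) ℤ.+ (signedSum us ws ℤ.+ + deficit us ws)
    ≡⟨ cong₂ ℤ._+_ (signVal-+-signDeficit u w) (signedSum-+-deficit us ws (suc-injective len)) ⟩
  + w ℤ.+ + sum ws
    ≡⟨ ℤ.pos-+ w (sum ws) ⟨
  + (w + sum ws) ∎
  where open ≡-Reasoning

signedSum≡⇒+deficit : ∀ us ws {k} → length us ≡ length ws →
                      signedSum us ws ≡ + k → k + deficit us ws ≡ sum ws
signedSum≡⇒+deficit us ws {k} len represents = ℤ.+-injective (begin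
  + (k + deficit us ws)               ≡⟨ ℤ.pos-+ k _ ⟩
  + k ℤ.+ + deficit us ws             ≡⟨ cong (λ x → x ℤ.+ + deficit us ws) represents ⟨
  signedSum us ws ℤ.+ + deficit us ws ≡⟨ signedSum-+-deficit us ws len ⟩
  + sum ws                            ∎)
  where open ≡-Reasoning

+deficit⇒signedSum≡ : ∀ us ws {k} → length us ≡ length ws →
                      k + deficit us ws ≡ sum ws → signedSum us ws ≡ + k
+deficit⇒signedSum≡ us ws {k} len k+D≡n = ∙-cancelʳ (+ deficit us ws) _ _ (begin
  signedSum us ws ℤ.+ + deficit us ws ≡⟨ signedSum-+-deficit us ws len ⟩
  + sum ws                            ≡⟨ cong +_ k+D≡n ⟨
  + (k + deficit us ws)               ≡⟨ ℤ.pos-+ k _ ⟩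
  + k ℤ.+ + deficit us ws             ∎)
  where open ≡-Reasoning

signDeficit≤2* : ∀ u w → signDeficit u w ≤ 2 * w
signDeficit≤2* neg w = ≤-reflexive (cong (_+_ w) (sym (+-identityʳ w)))
signDeficit≤2* zer w = m≤m+n w _
signDeficit≤2* pos w = z≤n

deficit≡0⊎≥ : ∀ ws us {w} → All (w ≤_) ws → deficit us ws ≡ 0 ⊎ w ≤ deficit us ws
deficit≡0⊎≥ []       []         _          = inj₁ refl
deficit≡0⊎≥ []       (_ ∷ _)    _          = inj₁ refl
deficit≡0⊎≥ (x ∷ xs) []         _          = inj₁ refl
deficit≡0⊎≥ (x ∷ xs) (neg ∷ us) (w≤x ∷ _)  = inj₂ (≤-trans w≤x (≤-trans (m≤m+n x x) (m≤m+n _ _)))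
deficit≡0⊎≥ (x ∷ xs) (zer ∷ us) (w≤x ∷ _)  = inj₂ (≤-trans w≤x (m≤m+n x _))
deficit≡0⊎≥ (x ∷ xs) (pos ∷ us) (_ ∷ w≤xs) = deficit≡0⊎≥ xs us w≤xs

deficit≤2R⊎≥ : ∀ j ws us {w} → All (w ≤_) (drop j ws) → deficit us ws ≤ 2 * R ws j ⊎ w ≤ deficit us ws
deficit≤2R⊎≥ zero    ws       us       w≤ws = map₁ ≤-reflexive (deficit≡0⊎≥ ws us w≤ws)
deficit≤2R⊎≥ (suc j) []       []       _ = inj₁ z≤n
deficit≤2R⊎≥ (suc j) []       (_ ∷ _)  _ = inj₁ z≤n
deficit≤2R⊎≥ (suc j) (x ∷ xs) []       _ = inj₁ z≤n
deficit≤2R⊎≥ (suc j) (x ∷ xs) (u ∷ us) w≤xs with deficit≤2R⊎≥ j xs us w≤xs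
... | inj₁ D≤2R = inj₁ (subst (signDeficit u x + deficit us xs ≤_) (sym (*-distribˡ-+ 2 x (R xs j)))
                             (+-mono-≤ (signDeficit≤2* u x) D≤2R))
... | inj₂ w≤D  = inj₂ (≤-trans w≤D (m≤n+m _ _))

sorted-lookup≤drop : ∀ {ws} → Sorted ≤-totalOrder ws → (i : Fin (length ws)) →
                     All (lookup ws i ≤_) (drop (toℕ i) ws)
sorted-lookup≤drop {x ∷ xs}     sorted       fzero       = Linked⇒All ≤-trans ≤-refl sorted
sorted-lookup≤drop {x ∷ y ∷ xs} (_ ∷ sorted) (fsuc i) = sorted-lookup≤drop sorted i

R-suc : ∀ ws (i : Fin (length ws)) → R ws (suc (toℕ i)) ≡ R ws (toℕ i) + lookup ws i
R-suc ws i = begin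
  sum (take (suc (toℕ i)) ws)          ≡⟨ cong sum (take-suc ws i) ⟩
  sum (take (toℕ i) ws ∷ʳ lookup ws i) ≡⟨ sum-++ (take (toℕ i) ws) _ ⟩
  R ws (toℕ i) + (lookup ws i + 0)     ≡⟨ cong (_+_ (R ws (toℕ i))) (+-identityʳ _) ⟩
  R ws (toℕ i) + lookup ws i           ∎
  where open ≡-Reasoning

R≤sum : ∀ j ws → R ws j ≤ sum ws
R≤sum zero    ws       = z≤n
R≤sum (suc j) []       = z≤n
R≤sum (suc j) (x ∷ xs) = +-monoʳ-≤ x (R≤sum j xs)

lookup≤2R+1 : ∀ ws → Sorted ≤-totalOrder ws → Covers (sum ws) ws → (i : Fin (length ws)) →
              lookup ws i ≤ 2 * R ws (toℕ i) + 1
lookup≤2R+1 ws sorted covers i with 2 * R ws (toℕ i) + 1 <? lookup ws i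
... | no  d≮w = ≮⇒≥ d≮w
... | yes d<w = contradiction (deficit≤2R⊎≥ (toℕ i) ws us (sorted-lookup≤drop sorted i)) impossible
  where
  n = sum ws
  r = R ws (toℕ i)
  w = lookup ws i
  d = 2 * r + 1
  d<n : d < n
  d<n = <-≤-trans d<w (≤-trans (m≤n+m w r) (subst (_≤ n) (R-suc ws i) (R≤sum (suc (toℕ i)) ws)))
  representation : Representable (n ∸ d) ws
  representation = covers (n ∸ d) (m<n⇒0<n∸m d<n) (m∸n≤m n d)
  us : List Sign
  us = proj₁ representation
  D≡d : deficit us ws ≡ d
  D≡d = +-cancelˡ-≡ (n ∸ d) _ _ (trans
    (signedSum≡⇒+deficit us ws (proj₁ (proj₂ representation)) (proj₂ (proj₂ representation)))
    (sym (m∸n+n≡m (<⇒≤ d<n))))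
  impossible : ¬ (deficit us ws ≤ 2 * r ⊎ w ≤ deficit us ws)
  impossible (inj₁ D≤2r) = <⇒≱ (m<m+n (2 * r) (s≤s z≤n)) (subst (_≤ 2 * r) D≡d D≤2r)
  impossible (inj₂ w≤D)  = <⇒≱ d<w (subst (w ≤_) D≡d w≤D)

2[r+w]+1≤3t : ∀ r w t → w ≤ 2 * r + 1 → 2 * r + 1 ≤ t → 2 * (r + w) + 1 ≤ 3 * t
2[r+w]+1≤3t r w t w≤2r+1 2r+1≤t = begin
  2 * (r + w) + 1               ≡⟨ regroup r w ⟩
  (2 * r + 1) + 2 * w           ≤⟨ +-monoʳ-≤ (2 * r + 1) (*-monoʳ-≤ 2 w≤2r+1) ⟩
  (2 * r + 1) + 2 * (2 * r + 1) ≡⟨ triple (2 * r + 1) ⟩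
  3 * (2 * r + 1)               ≤⟨ *-monoʳ-≤ 3 2r+1≤t ⟩
  3 * t                         ∎
  where
  open ≤-Reasoning
  regroup : ∀ r w → 2 * (r + w) + 1 ≡ (2 * r + 1) + 2 * w
  regroup = NatSolver.solve-∀
  triple : ∀ a → a + 2 * a ≡ 3 * a
  triple = NatSolver.solve-∀

2R+1≤3^ : ∀ ws → Sorted ≤-totalOrder ws → Covers (sum ws) ws →
          ∀ j → j ≤ length ws → 2 * R ws j + 1 ≤ 3 ^ j
2R+1≤3^ ws sorted covers zero    _     = ≤-refl
2R+1≤3^ ws sorted covers (suc j) j<len =
  subst (Bound ∘ suc) (toℕ-fromℕ< j<len)
    (subst (_≤ 3 ^ suc (toℕ i)) (cong (λ x → 2 * x + 1) (sym (R-suc ws i)))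
      (2[r+w]+1≤3t (R ws (toℕ i)) (lookup ws i) (3 ^ toℕ i) (lookup≤2R+1 ws sorted covers i)
        (subst Bound (sym (toℕ-fromℕ< j<len)) (2R+1≤3^ ws sorted covers j (<⇒≤ j<len)))))
  where
  Bound : ℕ → Set
  Bound k = 2 * R ws k + 1 ≤ 3 ^ k
  i = fromℕ< j<len

signedSum-↭ : ∀ {xs ys} → xs ↭ ys → ∀ us → length us ≡ length xs →
              Σ (List Sign) λ vs → length vs ≡ length ys × signedSum vs ys ≡ signedSum us xs
signedSum-↭ ↭.refl us len = us , len , refl
signedSum-↭ (↭.prep x xs↭ys) (u ∷ us) len with signedSum-↭ xs↭ys us (suc-injective len)
... | vs , len′ , same = u ∷ vs , cong suc len′ , cong (λ s → signVal u ℤ.* + x ℤ.+ s) same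
signedSum-↭ (↭.swap x y xs↭ys) (u ∷ v ∷ us) len with signedSum-↭ xs↭ys us (suc-injective (suc-injective len))
... | vs , len′ , same = v ∷ u ∷ vs , cong (suc ∘ suc) len′ , trans
  (cong (λ s → signVal v ℤ.* + y ℤ.+ (signVal u ℤ.* + x ℤ.+ s)) same)
  (x∙yz≈y∙xz (signVal v ℤ.* + y) (signVal u ℤ.* + x) _)
signedSum-↭ (↭.trans xs↭ys ys↭zs) us len with signedSum-↭ xs↭ys us len
... | vs , len′ , same with signedSum-↭ ys↭zs vs len′
...   | ts , len″ , same′ = ts , len″ , trans same′ same

Covers-↭ : ∀ {n xs ys} → xs ↭ ys → Covers n xs → Covers n ys
Covers-↭ xs↭ys covers k 1≤k k≤n with covers k 1≤k k≤n
... | us , len , represents with signedSum-↭ xs↭ys us len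
...   | vs , len′ , same = vs , len′ , trans same represents

covering-bound : ∀ ws → Covers (sum ws) ws → 2 * sum ws + 1 ≤ 3 ^ length ws
covering-bound ws covers = begin
  2 * sum ws + 1      ≡⟨ cong (λ x → 2 * x + 1) (sum-↭ ws↭ss) ⟩
  2 * sum ss + 1      ≡⟨ cong (λ xs → 2 * sum xs + 1) (take-all (length ss) ss ≤-refl) ⟨
  2 * R ss (length ss) + 1
    ≤⟨ 2R+1≤3^ ss (sort-↗ ws) (subst (λ n → Covers n ss) (sum-↭ ws↭ss) (Covers-↭ ws↭ss covers))
               (length ss) ≤-refl ⟩
  3 ^ length ss       ≡⟨ cong (3 ^_) (↭-length ws↭ss) ⟨
  3 ^ length ws       ∎
  where
  open ≤-Reasoning
  ss = sort ws
  ws↭ss : ws ↭ ss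
  ws↭ss = ↭-sym (sort-↭ ws)

powersOf3 : ℕ → List ℕ
powersOf3 = applyUpTo (3 ^_)

powersOf3-suc : ∀ m → powersOf3 (suc m) ≡ 1 ∷ map (3 *_) (powersOf3 m)
powersOf3-suc m = cong (1 ∷_) (sym (map-applyUpTo (3 ^_) (3 *_) m))

take-applyUpTo : ∀ {a} {A : Set a} (f : ℕ → A) {j m} → j ≤ m → take j (applyUpTo f m) ≡ applyUpTo f j
take-applyUpTo f z≤n       = refl
take-applyUpTo f (s≤s j≤m) = cong (f 0 ∷_) (take-applyUpTo (f ∘ suc) j≤m)

2*sum-powersOf3+1 : ∀ j → 2 * sum (powersOf3 j) + 1 ≡ 3 ^ j
2*sum-powersOf3+1 zero    = refl
2*sum-powersOf3+1 (suc j) = begin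
  2 * sum (powersOf3 (suc j)) + 1           ≡⟨ cong (λ xs → 2 * sum xs + 1) (applyUpTo-∷ʳ (3 ^_) j) ⟨
  2 * sum (powersOf3 j ∷ʳ 3 ^ j) + 1        ≡⟨ cong (λ s → 2 * s + 1) (sum-++ (powersOf3 j) _) ⟩
  2 * (sum (powersOf3 j) + (3 ^ j + 0)) + 1 ≡⟨ regroup (sum (powersOf3 j)) (3 ^ j) ⟩
  (2 * sum (powersOf3 j) + 1) + 2 * 3 ^ j   ≡⟨ cong (λ x → x + 2 * 3 ^ j) (2*sum-powersOf3+1 j) ⟩
  3 ^ j + 2 * 3 ^ j                         ≡⟨ triple (3 ^ j) ⟩
  3 ^ suc j                                 ∎
  where
  open ≡-Reasoning
  regroup : ∀ s p → 2 * (s + (p + 0)) + 1 ≡ (2 * s + 1) + 2 * p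
  regroup = NatSolver.solve-∀
  triple : ∀ p → p + 2 * p ≡ 3 * p
  triple = NatSolver.solve-∀

2*R-powersOf3+1 : ∀ {j m} → j ≤ m → 2 * R (powersOf3 m) j + 1 ≡ 3 ^ j
2*R-powersOf3+1 {j} j≤m = trans (cong (λ xs → 2 * sum xs + 1) (take-applyUpTo (3 ^_) j≤m)) (2*sum-powersOf3+1 j)

deficit-map-* : ∀ c us ws → deficit us (map (c *_) ws) ≡ c * deficit us ws
deficit-map-* c []       ws       = sym (*-zeroʳ c)
deficit-map-* c (u ∷ us) []       = sym (*-zeroʳ c)
deficit-map-* c (u ∷ us) (w ∷ ws) =
  trans (cong₂ _+_ (signDeficit-* u) (deficit-map-* c us ws)) (sym (*-distribˡ-+ c _ _))
  where
  signDeficit-* : ∀ u → signDeficit u (c * w) ≡ c * signDeficit u w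
  signDeficit-* neg = sym (*-distribˡ-+ c w w)
  signDeficit-* zer = refl
  signDeficit-* pos = sym (*-zeroʳ c)

-- The signs neg, zer, pos contribute the ternary digits 2, 1, 0 to the deficit.
ternary : ∀ m D → D < 3 ^ m → Σ (List Sign) λ us → length us ≡ m × deficit us (powersOf3 m) ≡ D
ternary zero    zero    _         = [] , refl , refl
ternary zero    (suc D) (s≤s ())
ternary (suc m) D       D<3^[1+m] with ternary m (D / 3) D/3<3^m | digit (D % 3) (m%n<n D 3)
  where
  D/3<3^m : D / 3 < 3 ^ m
  D/3<3^m = m<n*o⇒m/o<n (subst (D <_) (*-comm 3 (3 ^ m)) D<3^[1+m])
  digit : ∀ r → r < 3 → Σ Sign λ u → signDeficit u 1 ≡ r
  digit 0 _ = pos , refl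
  digit 1 _ = zer , refl
  digit 2 _ = neg , refl
  digit (suc (suc (suc r))) (s≤s (s≤s (s≤s ())))
... | us , len , D/3 | u , D%3 = u ∷ us , cong suc len , (begin
  deficit (u ∷ us) (powersOf3 (suc m))                    ≡⟨ cong (deficit (u ∷ us)) (powersOf3-suc m) ⟩
  signDeficit u 1 + deficit us (map (3 *_) (powersOf3 m)) ≡⟨ cong₂ _+_ D%3 (deficit-map-* 3 us _) ⟩
  D % 3 + 3 * deficit us (powersOf3 m)                    ≡⟨ cong (λ q → D % 3 + 3 * q) D/3 ⟩
  D % 3 + 3 * (D / 3)                                     ≡⟨ cong (_+_ (D % 3)) (*-comm 3 (D / 3)) ⟩
  D % 3 + D / 3 * 3                                       ≡⟨ m≡m%n+[m/n]*n D 3 ⟨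
  D                                                       ∎)
  where open ≡-Reasoning

sum-powersOf3<3^ : ∀ m → sum (powersOf3 m) < 3 ^ m
sum-powersOf3<3^ m = subst (sum (powersOf3 m) <_) (2*sum-powersOf3+1 m)
  (≤-<-trans (m≤m+n (sum (powersOf3 m)) _) (m<m+n (2 * sum (powersOf3 m)) (s≤s z≤n)))

powersOf3-covers : ∀ m → Covers (sum (powersOf3 m)) (powersOf3 m)
powersOf3-covers m k _ k≤n with ternary m (sum (powersOf3 m) ∸ k) (≤-<-trans (m∸n≤m _ k) (sum-powersOf3<3^ m))
... | us , len , D≡n∸k = us , len′ , +deficit⇒signedSum≡ us (powersOf3 m) len′ (trans (cong (_+_ k) D≡n∸k) (m+[n∸m]≡n k≤n))
  where
  len′ : length us ≡ length (powersOf3 m)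
  len′ = trans len (sym (length-applyUpTo (3 ^_) m))

powersOf3-minimal : ∀ m → Minimal (sum (powersOf3 m)) (powersOf3 m)
powersOf3-minimal m vs (_ , sum≡ , covers) =
  subst (_≤ length vs) (sym (length-applyUpTo (3 ^_) m))
    (≮⇒≥ λ len<m → <⇒≱ (^-monoʳ-< 3 (s≤s (s≤s z≤n)) len<m) 3^m≤3^len)
  where
  open ≤-Reasoning
  3^m≤3^len : 3 ^ m ≤ 3 ^ length vs
  3^m≤3^len = begin
    3 ^ m                        ≡⟨ 2*sum-powersOf3+1 m ⟨
    2 * sum (powersOf3 m) + 1    ≡⟨ cong (λ s → 2 * s + 1) sum≡ ⟨
    2 * sum vs + 1               ≤⟨ covering-bound vs (subst (λ n → Covers n vs) (sym sum≡) covers) ⟩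
    3 ^ length vs                ∎

powersOf3-feasible : ∀ m → Feasible (sum (powersOf3 m)) (powersOf3 m)
powersOf3-feasible m =
  Sorted.applyUpTo⁺₂ ≤-totalOrder (3 ^_) m (λ i → m≤n*m (3 ^ i) 3) ,
  (All.applyUpTo⁺₂ (3 ^_) m (m^n>0 3) , refl , powersOf3-covers m) ,
  powersOf3-minimal m

feasible-bounds : ∀ n ws → Feasible n ws → (i : Fin (length ws)) →
                  lookup ws i ≤ 3 ^ toℕ i × 2 * R ws (suc (toℕ i)) ≤ 3 ^ suc (toℕ i) ∸ 1
feasible-bounds n ws (sorted , (_ , sum≡n , covers) , _) i =
  ≤-trans (lookup≤2R+1 ws sorted covers′ i) (2R+1≤3^ ws sorted covers′ (toℕ i) (<⇒≤ (toℕ<n i))) ,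
  m+n≤o⇒m≤o∸n _ (2R+1≤3^ ws sorted covers′ (suc (toℕ i)) (toℕ<n i))
  where
  covers′ : Covers (sum ws) ws
  covers′ = subst (λ n → Covers n ws) (sym sum≡n) covers

powersOf3-extremal : ∀ m (i : Fin (length (powersOf3 m))) →
                     lookup (powersOf3 m) i ≡ 3 ^ toℕ i
                     × 2 * R (powersOf3 m) (suc (toℕ i)) ≡ 3 ^ suc (toℕ i) ∸ 1
powersOf3-extremal m i = lookup-applyUpTo (3 ^_) m i , trans (sym (m+n∸n≡m _ 1))
  (cong (_∸ 1) (2*R-powersOf3+1 (subst (toℕ i <_) (length-applyUpTo (3 ^_) m) (toℕ<n i))))

theorem3 : ((n : ℕ) → 1 ≤ n → (ws : List ℕ) → Feasible n ws →
             (i : Fin (length ws)) →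
               (lookup ws i ≤ 3 ^ toℕ i)
               × (2 * R ws (suc (toℕ i)) ≤ 3 ^ suc (toℕ i) ∸ 1))
           × ((m : ℕ) → 1 ≤ m →
             Σ ℕ λ n → Σ (List ℕ) λ ws →
               (length ws ≡ m) × Feasible n ws
               × ((i : Fin (length ws)) →
                   (lookup ws i ≡ 3 ^ toℕ i)
                   × (2 * R ws (suc (toℕ i)) ≡ 3 ^ suc (toℕ i) ∸ 1)))
theorem3 =
  (λ n _ → feasible-bounds n) ,
  λ m _ → sum (powersOf3 m) , powersOf3 m , length-applyUpTo (3 ^_) m ,
          powersOf3-feasible m , powersOf3-extremal m
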